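{- Let $T$ be a text whose last character is a sentinel $\$$ occurring nowhere else in $T$, and let $S$ be a repeated string in $T$, i.e. $f(S)\ge 2$. Define $L(S) := \{x \in \Sigma : f(xS)\ge 2\}$ and, for any string $P$, $r(P) := \{y \in \Sigma\cup\{\$\} : f(Py) = 1\}$. Then \[ \phi(S) = |r(S)| - \sum_{x\in L(S)} |r(xS)\cap r(S)| . \]
   Context: $\Sigma$ is a constant-size alphabet not containing $\$$. For a text $T$ of length $n$, $T[i\ldots j]$ denotes the substring from position $i$ to position $j$, and for a string $P$, $f(P)$ is the number of occurrences of $P$ in $T$ (the number of starting positions $i$ with $T[i\ldots i+|P|-1]=P$). A string $P$ is unique if $f(P)=1$ and repeated if $f(P)\ge 2$. An occurrence $(i,j)$ (meaning $T[i\ldots j]$) is a net occurrence if $f(T[i\ldots j])\ge 2$, $f(T[i-1\ldots j])=1$ and $f(T[i\ldots j+1])=1$, where by convention the condition $f(T[i-1\ldots j])=1$ is considered true when $i=1$ and $f(T[i\ldots j+1])=1$ is considered true when $j=n$. The net frequency $\phi(S)$ of a string $S$ in $T$ is the number of net occurrences $(i,j)$ with $T[i\ldots j]=S$ (in particular it is $0$ for unique strings). -}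

module Defs where

open import Data.Nat using (ℕ; zero; suc; _+_; _≡ᵇ_)
open import Data.Bool using (Bool; true; false; _∧_; if_then_else_)
open import Data.Fin using (Fin)
import Data.Fin as Fin
open import Data.Maybe using (Maybe; just; nothing)
import Data.Maybe.Properties as MaybeP
open import Data.List using (List; []; _∷_; _++_; length; drop; head; upTo; map; allFin)
open import Data.Nat.ListAction using (sum)
open import Relation.Nullary.Decidable using (does)

-- Extended alphabet Σ ∪ {$} for Σ = Fin σ : 'just a' is the letter a ∈ Σ,
-- 'nothing' is the sentinel $.
Char : ℕ → Set
Char σ = Maybe (Fin σ)

$ : ∀ {σ} → Char σ
$ = nothing

_≟c_ : ∀ {σ} → (a b : Char σ) → Bool
a ≟c b = does (MaybeP.≡-dec Fin._≟_ a b)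

isPrefix : ∀ {σ} → List (Char σ) → List (Char σ) → Bool
isPrefix []       _        = true
isPrefix (_ ∷ _)  []       = false
isPrefix (p ∷ ps) (t ∷ ts) = (p ≟c t) ∧ isPrefix ps ts

countB : ∀ {A : Set} → (A → Bool) → List A → ℕ
countB p xs = sum (map (λ x → if p x then 1 else 0) xs)

f : ∀ {σ} → List (Char σ) → List (Char σ) → ℕ
f T P = countB (λ i → isPrefix P (drop i T)) (upTo (length T))

charAt : ∀ {σ} → List (Char σ) → ℕ → Maybe (Char σ)
charAt T k = head (drop k T)

-- Is the occurrence of S starting at (0-indexed) position i a net occurrence?
-- (1-indexed: i+1 … j with j = i + |S|.)
isNetOcc : ∀ {σ} → List (Char σ) → List (Char σ) → ℕ → Bool
isNetOcc T S i = isPrefix S (drop i T) ∧ (2 Data.Nat.≤ᵇ f T S) ∧ left i ∧ right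
  where
  left : ℕ → Bool
  left zero    = true                       -- i = 1 (1-indexed): condition holds by convention
  left (suc k) with charAt T k
  ... | nothing = true
  ... | just c  = f T (c ∷ S) ≡ᵇ 1
  right : Bool
  right with charAt T (i + length S)
  ... | nothing = true                      -- j = n: condition holds by convention
  ... | just c  = f T (S ++ (c ∷ [])) ≡ᵇ 1

φ : ∀ {σ} → List (Char σ) → List (Char σ) → ℕ
φ T S = countB (isNetOcc T S) (upTo (length T))

letters : ∀ σ → List (Fin σ)
letters σ = allFin σ

extLetters : ∀ σ → List (Char σ)
extLetters σ = nothing ∷ map just (allFin σ)

rCard : ∀ {σ} → List (Char σ) → List (Char σ) → ℕ
rCard {σ} T P = countB (λ y → f T (P ++ (y ∷ [])) ≡ᵇ 1) (extLetters σ)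

rInterCard : ∀ {σ} → List (Char σ) → List (Char σ) → List (Char σ) → ℕ
rInterCard {σ} T P Q =
  countB (λ y → (f T (P ++ (y ∷ [])) ≡ᵇ 1) ∧ (f T (Q ++ (y ∷ [])) ≡ᵇ 1)) (extLetters σ)

sumL : ∀ {σ} → List (Char σ) → List (Char σ) → ℕ
sumL {σ} T S =
  sum (map (λ x → if (2 Data.Nat.≤ᵇ f T (just x ∷ S)) then rInterCard T (just x ∷ S) S else 0)
           (letters σ))

-- Count, for every occurrence i of S, the pair (T[i-1], T[i+|S|]) of its
-- neighbours.  Because S is repeated and $ occurs only at the end, every
-- occurrence has a right neighbour c, and |r(S)| is the number of occurrences
-- whose right neighbour c has f(Sc) = 1.  These occurrences split according to
-- the left condition: those with f(T[i-1..j]) = 1 are exactly the net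
-- occurrences, and those whose left neighbour x has f(xS) ≥ 2 are counted once
-- each in the sum, since f(Sc) = 1 forces f(xSc) = 1 and xSc then pins down
-- the occurrence.
module Submission where

open import Defs
open import Data.Nat using (ℕ; zero; suc; _+_; _*_; _∸_; _≤_; _<_; _≡ᵇ_; _≤ᵇ_; z≤n; s≤s; s≤s⁻¹)
open import Data.Nat.Properties
  using (+-identityʳ; +-comm; +-assoc; suc-injective; +-commutativeSemigroup; +-mono-≤; *-identityˡ; +-cancelʳ-≡;
         ≤-trans; ≤-refl; ≤-reflexive; <⇒≤; m≤n+m; m+n∸n≡m)
open import Data.Nat.ListAction using (sum)
open import Data.Bool using (Bool; true; false; _∧_; not; if_then_else_)
open import Data.Bool.Properties using (∧-assoc; ∧-comm; ∧-identityʳ; ∧-zeroʳ; ∧-conicalʳ)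
open import Data.Fin as Fin using (Fin)
import Data.Fin.Properties as Fin
open import Data.Maybe using (Maybe; just; nothing)
import Data.Maybe.Properties as Maybe
open import Data.List using (List; []; _∷_; _++_; _∷ʳ_; length; drop; head; map; upTo; applyUpTo; allFin)
open import Data.List.Properties using (map-cong; map-∘; map-tabulate; drop-drop; drop-all; length-++; length-map; ++-identityʳ; ++-conicalʳ)
open import Data.Product using (Σ-syntax; ∃-syntax; _,_)
open import Data.Empty using (⊥-elim)
open import Relation.Nullary using (yes)
open import Relation.Nullary.Decidable using (dec-true; dec-false)
open import Relation.Binary.PropositionalEquality
open import Function using (_∘_; id)
import Algebra.Properties.CommutativeSemigroup as CommutativeSemigroupProperties

open ≡-Reasoning

𝟙 : Bool → ℕ
𝟙 b = if b then 1 else 0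

∑ : ℕ → (ℕ → ℕ) → ℕ
∑ zero    g = 0
∑ (suc n) g = g 0 + ∑ n (g ∘ suc)

syntax ∑ n (λ i → e) = ∑[ i < n ] e

sum-map-applyUpTo : ∀ {A : Set} (g : A → ℕ) (h : ℕ → A) n →
                    sum (map g (applyUpTo h n)) ≡ ∑[ i < n ] g (h i)
sum-map-applyUpTo g h zero    = refl
sum-map-applyUpTo g h (suc n) = cong (g (h 0) +_) (sum-map-applyUpTo g (h ∘ suc) n)

sum-map-upTo : ∀ (g : ℕ → ℕ) n → sum (map g (upTo n)) ≡ ∑[ i < n ] g i
sum-map-upTo g = sum-map-applyUpTo g id

∑-cong : ∀ {g h : ℕ → ℕ} n → (∀ i → i < n → g i ≡ h i) → ∑[ i < n ] g i ≡ ∑[ i < n ] h i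
∑-cong zero    g≡h = refl
∑-cong (suc n) g≡h = cong₂ _+_ (g≡h 0 (s≤s z≤n)) (∑-cong n (λ i i<n → g≡h (suc i) (s≤s i<n)))

∑-zero : ∀ (g : ℕ → ℕ) n → (∀ i → g i ≡ 0) → ∑[ i < n ] g i ≡ 0
∑-zero g zero    g≡0 = refl
∑-zero g (suc n) g≡0 = cong₂ _+_ (g≡0 0) (∑-zero (g ∘ suc) n (g≡0 ∘ suc))

∑-distrib-+ : ∀ (g h : ℕ → ℕ) n → ∑[ i < n ] (g i + h i) ≡ ∑[ i < n ] g i + ∑[ i < n ] h i
∑-distrib-+ g h zero    = refl
∑-distrib-+ g h (suc n) = begin
  (g 0 + h 0) + ∑[ i < n ] (g (suc i) + h (suc i))
    ≡⟨ cong ((g 0 + h 0) +_) (∑-distrib-+ (g ∘ suc) (h ∘ suc) n) ⟩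
  (g 0 + h 0) + (∑ n (g ∘ suc) + ∑ n (h ∘ suc))
    ≡⟨ CommutativeSemigroupProperties.interchange +-commutativeSemigroup (g 0) (h 0) _ _ ⟩
  (g 0 + ∑ n (g ∘ suc)) + (h 0 + ∑ n (h ∘ suc)) ∎

∑-snoc : ∀ (g : ℕ → ℕ) n → ∑[ i < suc n ] g i ≡ ∑[ i < n ] g i + g n
∑-snoc g zero    = +-comm (g 0) 0
∑-snoc g (suc n) = trans (cong (g 0 +_) (∑-snoc (g ∘ suc) n)) (sym (+-assoc (g 0) _ _))

∑-mono : ∀ {g h : ℕ → ℕ} n → (∀ i → g i ≤ h i) → ∑[ i < n ] g i ≤ ∑[ i < n ] h i
∑-mono zero    g≤h = z≤n
∑-mono (suc n) g≤h = +-mono-≤ (g≤h 0) (∑-mono n (g≤h ∘ suc))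

∑-𝟙-∧ʳ : ∀ (p : ℕ → Bool) b n → ∑[ i < n ] 𝟙 (p i ∧ b) ≡ 𝟙 b * ∑[ i < n ] 𝟙 (p i)
∑-𝟙-∧ʳ p true  n = trans (∑-cong n (λ i _ → cong 𝟙 (∧-identityʳ (p i)))) (sym (*-identityˡ _))
∑-𝟙-∧ʳ p false n = ∑-zero _ n (λ i → cong 𝟙 (∧-zeroʳ (p i)))

∑-𝟙-pos : ∀ (p : ℕ → Bool) n k → k < n → p k ≡ true → 1 ≤ ∑[ i < n ] 𝟙 (p i)
∑-𝟙-pos p (suc n) zero    _         pk = subst (λ b → 1 ≤ 𝟙 b + ∑[ i < n ] 𝟙 (p (suc i))) (sym pk) (s≤s z≤n)
∑-𝟙-pos p (suc n) (suc k) (s≤s k<n) pk = ≤-trans (∑-𝟙-pos (p ∘ suc) n k k<n pk) (m≤n+m _ (𝟙 (p 0)))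

∑-𝟙-≤1 : ∀ (p : ℕ → Bool) n → (∀ j k → p j ≡ true → p k ≡ true → j ≡ k) → ∑[ i < n ] 𝟙 (p i) ≤ 1
∑-𝟙-≤1 p zero    _       = z≤n
∑-𝟙-≤1 p (suc n) at-most with p 0 in p0
... | true  = ≤-reflexive (cong suc (∑-zero _ n none-after))
  where
  none-after : ∀ i → 𝟙 (p (suc i)) ≡ 0
  none-after i with p (suc i) in pi
  ... | true  with () ← at-most (suc i) 0 pi p0
  ... | false = refl
... | false = ∑-𝟙-≤1 (p ∘ suc) n (λ j k pj pk → suc-injective (at-most (suc j) (suc k) pj pk))

sum-map-zero : ∀ {A : Set} (g : A → ℕ) xs → (∀ x → g x ≡ 0) → sum (map g xs) ≡ 0
sum-map-zero g []       g≡0 = refl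
sum-map-zero g (x ∷ xs) g≡0 = cong₂ _+_ (g≡0 x) (sum-map-zero g xs g≡0)

∑-sum-map-comm : ∀ {A : Set} (g : ℕ → A → ℕ) xs n →
                 ∑[ i < n ] sum (map (g i) xs) ≡ sum (map (λ x → ∑[ i < n ] g i x) xs)
∑-sum-map-comm g []       n = ∑-zero _ n (λ _ → refl)
∑-sum-map-comm g (x ∷ xs) n =
  trans (∑-distrib-+ (λ i → g i x) (λ i → sum (map (g i) xs)) n)
        (cong (∑[ i < n ] g i x +_) (∑-sum-map-comm g xs n))

𝟙-∧-≤ˡ : ∀ a b → 𝟙 (a ∧ b) ≤ 𝟙 a
𝟙-∧-≤ˡ true  true  = ≤-refl
𝟙-∧-≤ˡ true  false = z≤n
𝟙-∧-≤ˡ false b     = z≤n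

𝟙-split : ∀ a l r → 𝟙 (a ∧ l ∧ r) + 𝟙 (a ∧ not l ∧ r) ≡ 𝟙 (a ∧ r)
𝟙-split true  true  r = +-identityʳ (𝟙 r)
𝟙-split true  false r = refl
𝟙-split false l     r = refl

𝟙[m≡ᵇ1]*m : ∀ m → 𝟙 (m ≡ᵇ 1) * m ≡ 𝟙 (m ≡ᵇ 1)
𝟙[m≡ᵇ1]*m zero          = refl
𝟙[m≡ᵇ1]*m (suc zero)    = refl
𝟙[m≡ᵇ1]*m (suc (suc m)) = refl

𝟙[m≡ᵇ1∧b] : ∀ m b → (b ≡ true → m ≤ 1) → 𝟙 ((m ≡ᵇ 1) ∧ b) ≡ 𝟙 b * m
𝟙[m≡ᵇ1∧b] zero          false _   = refl
𝟙[m≡ᵇ1∧b] (suc zero)    false _   = refl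
𝟙[m≡ᵇ1∧b] (suc (suc m)) false _   = refl
𝟙[m≡ᵇ1∧b] zero          true  _   = refl
𝟙[m≡ᵇ1∧b] (suc zero)    true  _   = refl
𝟙[m≡ᵇ1∧b] (suc (suc m)) true  m≤1 with s≤s () ← m≤1 refl

≡ᵇ1⇒≡1 : ∀ {m} → (m ≡ᵇ 1) ≡ true → m ≡ 1
≡ᵇ1⇒≡1 {zero}          ()
≡ᵇ1⇒≡1 {suc zero}      _  = refl
≡ᵇ1⇒≡1 {suc (suc m)}   ()

2≤⇒2≤ᵇ : ∀ {m} → 2 ≤ m → (2 ≤ᵇ m) ≡ true
2≤⇒2≤ᵇ (s≤s (s≤s _)) = refl

2≤ᵇm≡not[m≡ᵇ1] : ∀ m → 1 ≤ m → (2 ≤ᵇ m) ≡ not (m ≡ᵇ 1)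
2≤ᵇm≡not[m≡ᵇ1] (suc zero)    _ = refl
2≤ᵇm≡not[m≡ᵇ1] (suc (suc m)) _ = refl

≟c-refl : ∀ {σ} (a : Char σ) → (a ≟c a) ≡ true
≟c-refl a = dec-true (Maybe.≡-dec Fin._≟_ a a) refl

≟c-false : ∀ {σ} {a b : Char σ} → a ≢ b → (a ≟c b) ≡ false
≟c-false {a = a} {b} = dec-false (Maybe.≡-dec Fin._≟_ a b)

≟c-sound : ∀ {σ} {a b : Char σ} → (a ≟c b) ≡ true → a ≡ b
≟c-sound {a = a} {b} a≟b with Maybe.≡-dec Fin._≟_ a b
... | yes a≡b = a≡b

hasChar : ∀ {σ} → Maybe (Char σ) → Char σ → Bool
hasChar nothing  _ = false
hasChar (just t) y = y ≟c t

hasChar-sound : ∀ {σ} (m : Maybe (Char σ)) y → hasChar m y ≡ true → m ≡ just y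
hasChar-sound (just t) y y≟t = cong just (sym (≟c-sound y≟t))

sum-map-allFin-suc : ∀ {σ} (g : Fin (suc σ) → ℕ) →
                     sum (map g (allFin (suc σ))) ≡ g Fin.zero + sum (map (g ∘ Fin.suc) (allFin σ))
sum-map-allFin-suc g =
  cong (λ xs → g Fin.zero + sum xs) (trans (map-tabulate Fin.suc g) (sym (map-tabulate id (g ∘ Fin.suc))))

sum-allFin-select : ∀ {σ} (a : Fin σ) (g : Fin σ → ℕ) → (∀ x → x ≢ a → g x ≡ 0) →
                    sum (map g (allFin σ)) ≡ g a
sum-allFin-select {suc σ} Fin.zero g g≡0 = begin
  sum (map g (allFin (suc σ)))                          ≡⟨ sum-map-allFin-suc g ⟩
  g Fin.zero + sum (map (g ∘ Fin.suc) (allFin σ))        ≡⟨ cong (g Fin.zero +_) (sum-map-zero (g ∘ Fin.suc) (allFin σ) (λ x → g≡0 (Fin.suc x) (λ ()))) ⟩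
  g Fin.zero + 0                                        ≡⟨ +-identityʳ _ ⟩
  g Fin.zero                                            ∎
sum-allFin-select {suc σ} (Fin.suc a) g g≡0 = begin
  sum (map g (allFin (suc σ)))                          ≡⟨ sum-map-allFin-suc g ⟩
  g Fin.zero + sum (map (g ∘ Fin.suc) (allFin σ))        ≡⟨ cong (_+ sum (map (g ∘ Fin.suc) (allFin σ))) (g≡0 Fin.zero (λ ())) ⟩
  sum (map (g ∘ Fin.suc) (allFin σ))                     ≡⟨ sum-allFin-select a (g ∘ Fin.suc) (λ x x≢a → g≡0 (Fin.suc x) (x≢a ∘ Fin.suc-injective)) ⟩
  g (Fin.suc a)                                         ∎

sum-extLetters-select : ∀ {σ} (c : Char σ) (g : Char σ → ℕ) → (∀ y → y ≢ c → g y ≡ 0) →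
                        sum (map g (extLetters σ)) ≡ g c
sum-extLetters-select {σ} nothing g g≡0 = begin
  g nothing + sum (map g (map just (allFin σ)))   ≡⟨ cong (g nothing +_) (cong sum (sym (map-∘ (allFin σ)))) ⟩
  g nothing + sum (map (g ∘ just) (allFin σ))     ≡⟨ cong (g nothing +_) (sum-map-zero (g ∘ just) (allFin σ) (λ x → g≡0 (just x) (λ ()))) ⟩
  g nothing + 0                                   ≡⟨ +-identityʳ _ ⟩
  g nothing                                       ∎
sum-extLetters-select {σ} (just a) g g≡0 = begin
  g nothing + sum (map g (map just (allFin σ)))   ≡⟨ cong₂ _+_ (g≡0 nothing (λ ())) (cong sum (sym (map-∘ (allFin σ)))) ⟩
  sum (map (g ∘ just) (allFin σ))                 ≡⟨ sum-allFin-select a (g ∘ just) (λ x x≢a → g≡0 (just x) (x≢a ∘ Maybe.just-injective)) ⟩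
  g (just a)                                      ∎

isPrefix-∷ : ∀ {σ} (x : Char σ) P L → isPrefix (x ∷ P) L ≡ hasChar (head L) x ∧ isPrefix P (drop 1 L)
isPrefix-∷ x P []      = refl
isPrefix-∷ x P (t ∷ L) = refl

isPrefix-∷ʳ : ∀ {σ} (P : List (Char σ)) y L →
              isPrefix (P ∷ʳ y) L ≡ isPrefix P L ∧ hasChar (head (drop (length P) L)) y
isPrefix-∷ʳ []      y []      = refl
isPrefix-∷ʳ []      y (t ∷ L) = ∧-identityʳ (y ≟c t)
isPrefix-∷ʳ (p ∷ P) y []      = refl
isPrefix-∷ʳ (p ∷ P) y (t ∷ L) =
  trans (cong ((p ≟c t) ∧_) (isPrefix-∷ʳ P y L)) (sym (∧-assoc (p ≟c t) _ _))

isPrefix-[] : ∀ {σ} (P : List (Char σ)) → P ≢ [] → isPrefix P [] ≡ false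
isPrefix-[] []      P≢[] = ⊥-elim (P≢[] refl)
isPrefix-[] (p ∷ P) _    = refl

isPrefix⇒++-drop : ∀ {σ} (P L : List (Char σ)) → isPrefix P L ≡ true → P ++ drop (length P) L ≡ L
isPrefix⇒++-drop []      L       _     = refl
isPrefix⇒++-drop (p ∷ P) []      ()
isPrefix⇒++-drop (p ∷ P) (t ∷ L) P⊑tL with p ≟c t in p≟t
... | true = cong₂ _∷_ (≟c-sound p≟t) (isPrefix⇒++-drop P L P⊑tL)

∷ʳ-≢-[] : ∀ {A : Set} (P : List A) y → P ∷ʳ y ≢ []
∷ʳ-≢-[] P y eq with () ← ++-conicalʳ P (y ∷ []) eq

head≡nothing⇒[] : ∀ {A : Set} (xs : List A) → head xs ≡ nothing → xs ≡ []
head≡nothing⇒[] [] _ = refl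

module Occurrences {σ} (T : List (Char σ)) where

  n : ℕ
  n = length T

  occ : List (Char σ) → ℕ → Bool
  occ P i = isPrefix P (drop i T)

  before : ℕ → Char σ → Bool
  before zero    _ = false
  before (suc k) x = hasChar (charAt T k) x

  f≡∑ : ∀ P → f T P ≡ ∑[ i < n ] 𝟙 (occ P i)
  f≡∑ P = sum-map-upTo (λ i → 𝟙 (occ P i)) n

  occ-∷ : ∀ x P k → occ (x ∷ P) k ≡ before (suc k) x ∧ occ P (suc k)
  occ-∷ x P k =
    trans (isPrefix-∷ x P (drop k T))
          (cong (λ L → hasChar (charAt T k) x ∧ isPrefix P L)
                (trans (drop-drop k 1 T) (cong (λ m → drop m T) (+-comm k 1))))

  occ-∷ʳ : ∀ P y i → occ (P ∷ʳ y) i ≡ occ P i ∧ hasChar (charAt T (i + length P)) y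
  occ-∷ʳ P y i =
    trans (isPrefix-∷ʳ P y (drop i T))
          (cong (λ L → occ P i ∧ hasChar (head L) y) (drop-drop i (length P) T))

  f-∷ʳ : ∀ P y → f T (P ∷ʳ y) ≡ ∑[ i < n ] 𝟙 (occ P i ∧ hasChar (charAt T (i + length P)) y)
  f-∷ʳ P y = trans (f≡∑ (P ∷ʳ y)) (∑-cong n (λ i _ → cong 𝟙 (occ-∷ʳ P y i)))

  -- Reindexing the occurrence k of xP as the occurrence k + 1 of P; the extra
  -- last term vanishes because a nonempty P cannot occur at position n.
  f-∷ : ∀ x P → P ≢ [] → f T (x ∷ P) ≡ ∑[ i < n ] 𝟙 (occ P i ∧ before i x)
  f-∷ x P P≢[] = begin
    f T (x ∷ P)                                                ≡⟨ f≡∑ (x ∷ P) ⟩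
    ∑[ k < n ] 𝟙 (occ (x ∷ P) k)                               ≡⟨ ∑-cong n (λ k _ → cong 𝟙 (occ-∷ x P k)) ⟩
    ∑[ i < suc n ] 𝟙 (before i x ∧ occ P i)                     ≡⟨ ∑-snoc _ n ⟩
    ∑[ i < n ] 𝟙 (before i x ∧ occ P i) + 𝟙 (before n x ∧ occ P n)
      ≡⟨ cong (λ b → ∑[ i < n ] 𝟙 (before i x ∧ occ P i) + 𝟙 (before n x ∧ b)) occ-at-end ⟩
    ∑[ i < n ] 𝟙 (before i x ∧ occ P i) + 𝟙 (before n x ∧ false)
      ≡⟨ cong (λ b → ∑[ i < n ] 𝟙 (before i x ∧ occ P i) + 𝟙 b) (∧-zeroʳ (before n x)) ⟩
    ∑[ i < n ] 𝟙 (before i x ∧ occ P i) + 0                    ≡⟨ +-identityʳ _ ⟩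
    ∑[ i < n ] 𝟙 (before i x ∧ occ P i)                        ≡⟨ ∑-cong n (λ i _ → cong 𝟙 (∧-comm (before i x) (occ P i))) ⟩
    ∑[ i < n ] 𝟙 (occ P i ∧ before i x)                        ∎
    where
    occ-at-end : occ P n ≡ false
    occ-at-end = trans (cong (isPrefix P) (drop-all n T ≤-refl)) (isPrefix-[] P P≢[])

  f-∷-∷ʳ : ∀ x P y → f T (x ∷ P ∷ʳ y) ≡ ∑[ i < n ] 𝟙 ((occ P i ∧ hasChar (charAt T (i + length P)) y) ∧ before i x)
  f-∷-∷ʳ x P y =
    trans (f-∷ x (P ∷ʳ y) (∷ʳ-≢-[] P y))
          (∑-cong n (λ i _ → cong (λ b → 𝟙 (b ∧ before i x)) (occ-∷ʳ P y i)))

  f-∷-≤ : ∀ x P → P ≢ [] → f T (x ∷ P) ≤ f T P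
  f-∷-≤ x P P≢[] =
    subst₂ _≤_ (sym (f-∷ x P P≢[])) (sym (f≡∑ P)) (∑-mono n (λ i → 𝟙-∧-≤ˡ (occ P i) (before i x)))

  occ⇒f-pos : ∀ P i → i < n → occ P i ≡ true → 1 ≤ f T P
  occ⇒f-pos P i i<n occurs = subst (1 ≤_) (sym (f≡∑ P)) (∑-𝟙-pos (occ P) n i i<n occurs)

charAt-letter : ∀ {σ} (w : List (Fin σ)) k → k < length w → ∃[ a ] charAt (map just w ∷ʳ $) k ≡ just (just a)
charAt-letter (a ∷ w) zero    _         = a , refl
charAt-letter (a ∷ w) (suc k) (s≤s k<w) = charAt-letter w k k<w

charAt≡$ : ∀ {σ} (w : List (Fin σ)) k → charAt (map just w ∷ʳ $) k ≡ just $ → k ≡ length w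
charAt≡$ []      zero          _  = refl
charAt≡$ []      (suc zero)    ()
charAt≡$ []      (suc (suc k)) ()
charAt≡$ (a ∷ w) zero          ()
charAt≡$ (a ∷ w) (suc k)       eq = cong suc (charAt≡$ w k eq)

drop-∷ʳ$ : ∀ {σ} (w : List (Fin σ)) i → i ≤ length w → drop i (map just w ∷ʳ $) ≡ map just (drop i w) ∷ʳ $
drop-∷ʳ$ w       zero    _         = refl
drop-∷ʳ$ (a ∷ w) (suc i) (s≤s i≤w) = drop-∷ʳ$ w i i≤w

module Sentinel {σ} (w : List (Fin σ)) where

  T : List (Char σ)
  T = map just w ∷ʳ $

  open Occurrences T public

  n≡1+|w| : n ≡ suc (length w)
  n≡1+|w| = trans (length-++ (map just w)) (trans (cong (_+ 1) (length-map just w)) (+-comm (length w) 1))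

  before-letter : ∀ k → suc k < n → ∃[ a ] charAt T k ≡ just (just a)
  before-letter k k+1<n = charAt-letter w k (s≤s⁻¹ (subst (suc k <_) n≡1+|w| k+1<n))

  f-∷ʳ$-≤1 : ∀ P → f T (P ∷ʳ $) ≤ 1
  f-∷ʳ$-≤1 P = subst (_≤ 1) (sym (f-∷ʳ P $)) (∑-𝟙-≤1 occurs n same-end)
    where
    occurs : ℕ → Bool
    occurs j = occ P j ∧ hasChar (charAt T (j + length P)) $
    ends-at-$ : ∀ j → occurs j ≡ true → j + length P ≡ length w
    ends-at-$ j occurs-j = charAt≡$ w _ (hasChar-sound _ $ (∧-conicalʳ _ _ occurs-j))
    same-end : ∀ j k → occurs j ≡ true → occurs k ≡ true → j ≡ k
    same-end j k occurs-j occurs-k =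
      +-cancelʳ-≡ (length P) j k (trans (ends-at-$ j occurs-j) (sym (ends-at-$ k occurs-k)))

  occ-at-end⇒suffix : ∀ S i → i < n → occ S i ≡ true → charAt T (i + length S) ≡ nothing →
                      S ≡ map just (drop i w) ∷ʳ $
  occ-at-end⇒suffix S i i<n occurs at-end = begin
    S                                 ≡⟨ ++-identityʳ S ⟨
    S ++ []                           ≡⟨ cong (S ++_) (head≡nothing⇒[] _ (trans (cong head (drop-drop i (length S) T)) at-end)) ⟨
    S ++ drop (length S) (drop i T)   ≡⟨ isPrefix⇒++-drop S (drop i T) occurs ⟩
    drop i T                          ≡⟨ drop-∷ʳ$ w i (s≤s⁻¹ (subst (i <_) n≡1+|w| i<n)) ⟩
    map just (drop i w) ∷ʳ $          ∎

  -- An occurrence reaching the end of T is a suffix, so it ends with $ and is unique.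
  repeated⇒successor : ∀ {S} → 2 ≤ f T S → ∀ i → i < n → occ S i ≡ true → ∃[ c ] charAt T (i + length S) ≡ just c
  repeated⇒successor {S} 2≤f i i<n occurs with charAt T (i + length S) in at-end
  ... | just c  = c , refl
  ... | nothing with s≤s () ← ≤-trans 2≤f (subst (λ Q → f T Q ≤ 1) (sym (occ-at-end⇒suffix S i i<n occurs at-end)) (f-∷ʳ$-≤1 (map just (drop i w))))

module NetFrequency {σ} (w : List (Fin σ)) (S : List (Char σ)) (2≤f : 2 ≤ f (map just w ∷ʳ $) S) where

  open Sentinel w

  inR : Char σ → Bool
  inR y = f T (S ∷ʳ y) ≡ᵇ 1

  inL : Fin σ → Bool
  inL x = 2 ≤ᵇ f T (just x ∷ S)

  next : ℕ → Maybe (Char σ)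
  next i = charAt T (i + length S)

  uniqueAfter : Maybe (Char σ) → Bool
  uniqueAfter nothing  = true
  uniqueAfter (just y) = inR y

  uniqueBefore : Maybe (Char σ) → Bool
  uniqueBefore nothing  = true
  uniqueBefore (just x) = f T (x ∷ S) ≡ᵇ 1

  rightUnique : ℕ → Bool
  rightUnique i = uniqueAfter (next i)

  leftUnique : ℕ → Bool
  leftUnique zero    = true
  leftUnique (suc k) = uniqueBefore (charAt T k)

  isNetOcc≡ : ∀ i → isNetOcc T S i ≡ occ S i ∧ (2 ≤ᵇ f T S) ∧ leftUnique i ∧ rightUnique i
  isNetOcc≡ zero with charAt T (zero + length S)
  ... | nothing = refl
  ... | just _  = refl
  isNetOcc≡ (suc k) with charAt T k | charAt T (suc k + length S)
  ... | nothing | nothing = refl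
  ... | nothing | just _  = refl
  ... | just _  | nothing = refl
  ... | just _  | just _  = refl

  φ≡∑ : φ T S ≡ ∑[ i < n ] 𝟙 (occ S i ∧ leftUnique i ∧ rightUnique i)
  φ≡∑ = trans (sum-map-upTo _ n)
              (∑-cong n (λ i _ → cong 𝟙 (trans (isNetOcc≡ i)
                                               (cong (λ b → occ S i ∧ b ∧ leftUnique i ∧ rightUnique i) (2≤⇒2≤ᵇ 2≤f)))))

  successor : ∀ i → i < n → occ S i ≡ true → ∃[ c ] next i ≡ just c
  successor = repeated⇒successor {S} 2≤f

  sum-extLetters-hasChar : ∀ {m : Maybe (Char σ)} {c} → m ≡ just c → (q : Char σ → Bool) →
                           sum (map (λ y → 𝟙 (hasChar m y ∧ q y)) (extLetters σ)) ≡ 𝟙 (q c)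
  sum-extLetters-hasChar {c = c} refl q =
    trans (sum-extLetters-select c _ (λ y y≢c → cong (λ b → 𝟙 (b ∧ q y)) (≟c-false y≢c)))
          (cong (λ b → 𝟙 (b ∧ q c)) (≟c-refl c))

  sum-allFin-hasChar : ∀ {m : Maybe (Char σ)} {a} → m ≡ just (just a) → (q : Fin σ → Bool) →
                       sum (map (λ x → 𝟙 (hasChar m (just x) ∧ q x)) (allFin σ)) ≡ 𝟙 (q a)
  sum-allFin-hasChar {a = a} refl q =
    trans (sum-allFin-select a _ (λ x x≢a → cong (λ b → 𝟙 (b ∧ q x)) (≟c-false (x≢a ∘ Maybe.just-injective))))
          (cong (λ b → 𝟙 (b ∧ q a)) (≟c-refl (just a)))

  inR-count : ∀ y → 𝟙 (inR y) ≡ ∑[ i < n ] 𝟙 ((occ S i ∧ hasChar (next i) y) ∧ inR y)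
  inR-count y = begin
    𝟙 (inR y)                                                 ≡⟨ 𝟙[m≡ᵇ1]*m (f T (S ∷ʳ y)) ⟨
    𝟙 (inR y) * f T (S ∷ʳ y)                                  ≡⟨ cong (𝟙 (inR y) *_) (f-∷ʳ S y) ⟩
    𝟙 (inR y) * ∑[ i < n ] 𝟙 (occ S i ∧ hasChar (next i) y)   ≡⟨ ∑-𝟙-∧ʳ (λ i → occ S i ∧ hasChar (next i) y) (inR y) n ⟨
    ∑[ i < n ] 𝟙 ((occ S i ∧ hasChar (next i) y) ∧ inR y)    ∎

  inR-count-at : ∀ i → i < n →
    sum (map (λ y → 𝟙 ((occ S i ∧ hasChar (next i) y) ∧ inR y)) (extLetters σ)) ≡ 𝟙 (occ S i ∧ rightUnique i)
  inR-count-at i i<n with occ S i in occurs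
  ... | false = sum-map-zero _ (extLetters σ) (λ _ → refl)
  ... | true with successor i i<n occurs
  ... | c , next≡c = trans (sum-extLetters-hasChar next≡c inR) (cong (𝟙 ∘ uniqueAfter) (sym next≡c))

  rCard≡∑ : rCard T S ≡ ∑[ i < n ] 𝟙 (occ S i ∧ rightUnique i)
  rCard≡∑ = begin
    sum (map (𝟙 ∘ inR) (extLetters σ))
      ≡⟨ cong sum (map-cong inR-count (extLetters σ)) ⟩
    sum (map (λ y → ∑[ i < n ] 𝟙 ((occ S i ∧ hasChar (next i) y) ∧ inR y)) (extLetters σ))
      ≡⟨ ∑-sum-map-comm (λ i y → 𝟙 ((occ S i ∧ hasChar (next i) y) ∧ inR y)) (extLetters σ) n ⟨
    ∑[ i < n ] sum (map (λ y → 𝟙 ((occ S i ∧ hasChar (next i) y) ∧ inR y)) (extLetters σ))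
      ≡⟨ ∑-cong n inR-count-at ⟩
    ∑[ i < n ] 𝟙 (occ S i ∧ rightUnique i) ∎

  -- The occurrence i of S, read as an occurrence of xSy with x ∈ L(S) and y ∈ r(S).
  extensionAt : ℕ → Fin σ → Char σ → ℕ
  extensionAt i x y = 𝟙 ((occ S i ∧ hasChar (next i) y) ∧ before i (just x) ∧ inL x ∧ inR y)

  extension-count : ∀ x y b →
    ∑[ i < n ] 𝟙 ((occ S i ∧ hasChar (next i) y) ∧ before i x ∧ b) ≡ 𝟙 b * f T (x ∷ S ∷ʳ y)
  extension-count x y b = begin
    ∑[ i < n ] 𝟙 ((occ S i ∧ hasChar (next i) y) ∧ before i x ∧ b)
      ≡⟨ ∑-cong n (λ i _ → cong 𝟙 (∧-assoc (occ S i ∧ hasChar (next i) y) (before i x) b)) ⟨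
    ∑[ i < n ] 𝟙 (((occ S i ∧ hasChar (next i) y) ∧ before i x) ∧ b)
      ≡⟨ ∑-𝟙-∧ʳ (λ i → (occ S i ∧ hasChar (next i) y) ∧ before i x) b n ⟩
    𝟙 b * ∑[ i < n ] 𝟙 ((occ S i ∧ hasChar (next i) y) ∧ before i x)
      ≡⟨ cong (𝟙 b *_) (f-∷-∷ʳ x S y) ⟨
    𝟙 b * f T (x ∷ S ∷ʳ y) ∎

  inL-count : ∀ x → (if inL x then rInterCard T (just x ∷ S) S else 0)
                    ≡ sum (map (λ y → ∑[ i < n ] extensionAt i x y) (extLetters σ))
  inL-count x =
    trans (restrict (inL x))
          (cong sum (map-cong (λ y → sym (extension-count (just x) y (inL x ∧ inR y))) (extLetters σ)))
    where
    unique-extension : ∀ y → inR y ≡ true → f T (just x ∷ S ∷ʳ y) ≤ 1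
    unique-extension y Sy-unique =
      ≤-trans (f-∷-≤ (just x) (S ∷ʳ y) (∷ʳ-≢-[] S y)) (≤-reflexive (≡ᵇ1⇒≡1 Sy-unique))
    restrict : ∀ b → (if b then rInterCard T (just x ∷ S) S else 0)
                     ≡ sum (map (λ y → 𝟙 (b ∧ inR y) * f T (just x ∷ S ∷ʳ y)) (extLetters σ))
    restrict false = sym (sum-map-zero _ (extLetters σ) (λ _ → refl))
    restrict true  =
      cong sum (map-cong (λ y → 𝟙[m≡ᵇ1∧b] (f T (just x ∷ S ∷ʳ y)) (inR y) (unique-extension y)) (extLetters σ))

  -- Since $ occurs only at the end, the character before an inner occurrence is a letter.
  inL-before : ∀ c i → i < n → occ S i ≡ true →
    sum (map (λ x → 𝟙 (before i (just x) ∧ inL x ∧ inR c)) (allFin σ)) ≡ 𝟙 (not (leftUnique i) ∧ inR c)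
  inL-before c zero    _   _      = sum-map-zero _ (allFin σ) (λ _ → refl)
  inL-before c (suc k) i<n occurs with before-letter k i<n
  ... | a , charAt≡a = begin
    sum (map (λ x → 𝟙 (before (suc k) (just x) ∧ inL x ∧ inR c)) (allFin σ)) ≡⟨ sum-allFin-hasChar charAt≡a (λ x → inL x ∧ inR c) ⟩
    𝟙 (inL a ∧ inR c)                                                     ≡⟨ cong (λ b → 𝟙 (b ∧ inR c)) inL≡not-unique ⟩
    𝟙 (not (leftUnique (suc k)) ∧ inR c)                                  ∎
    where
    aS-occurs : occ (just a ∷ S) k ≡ true
    aS-occurs = trans (occ-∷ (just a) S k)
                      (cong₂ _∧_ (trans (cong (λ m → hasChar m (just a)) charAt≡a) (≟c-refl (just a))) occurs)
    inL≡not-unique : inL a ≡ not (leftUnique (suc k))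
    inL≡not-unique = trans (2≤ᵇm≡not[m≡ᵇ1] _ (occ⇒f-pos (just a ∷ S) k (<⇒≤ i<n) aS-occurs))
                           (cong (not ∘ uniqueBefore) (sym charAt≡a))

  inL-count-at : ∀ i → i < n →
    sum (map (λ x → sum (map (λ y → 𝟙 ((occ S i ∧ hasChar (next i) y) ∧ before i (just x) ∧ inL x ∧ inR y))
                             (extLetters σ)))
             (allFin σ))
    ≡ 𝟙 (occ S i ∧ not (leftUnique i) ∧ rightUnique i)
  inL-count-at i i<n with occ S i in occurs
  ... | false = sum-map-zero _ (allFin σ) (λ _ → sum-map-zero _ (extLetters σ) (λ _ → refl))
  ... | true with successor i i<n occurs
  ... | c , next≡c = begin
    sum (map (λ x → sum (map (λ y → 𝟙 (hasChar (next i) y ∧ before i (just x) ∧ inL x ∧ inR y)) (extLetters σ)))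
             (allFin σ))
      ≡⟨ cong sum (map-cong (λ x → sum-extLetters-hasChar next≡c (λ y → before i (just x) ∧ inL x ∧ inR y)) (allFin σ)) ⟩
    sum (map (λ x → 𝟙 (before i (just x) ∧ inL x ∧ inR c)) (allFin σ))
      ≡⟨ inL-before c i i<n occurs ⟩
    𝟙 (not (leftUnique i) ∧ inR c)
      ≡⟨ cong (λ m → 𝟙 (not (leftUnique i) ∧ uniqueAfter m)) next≡c ⟨
    𝟙 (not (leftUnique i) ∧ rightUnique i) ∎

  sumL≡∑ : sumL T S ≡ ∑[ i < n ] 𝟙 (occ S i ∧ not (leftUnique i) ∧ rightUnique i)
  sumL≡∑ = begin
    sumL T S
      ≡⟨ cong sum (map-cong inL-count (allFin σ)) ⟩
    sum (map (λ x → sum (map (λ y → ∑[ i < n ] extensionAt i x y) (extLetters σ))) (allFin σ))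
      ≡⟨ cong sum (map-cong (λ x → ∑-sum-map-comm (λ i y → extensionAt i x y) (extLetters σ) n) (allFin σ)) ⟨
    sum (map (λ x → ∑[ i < n ] sum (map (extensionAt i x) (extLetters σ))) (allFin σ))
      ≡⟨ ∑-sum-map-comm (λ i x → sum (map (extensionAt i x) (extLetters σ))) (allFin σ) n ⟨
    ∑[ i < n ] sum (map (λ x → sum (map (extensionAt i x) (extLetters σ))) (allFin σ))
      ≡⟨ ∑-cong n inL-count-at ⟩
    ∑[ i < n ] 𝟙 (occ S i ∧ not (leftUnique i) ∧ rightUnique i) ∎

  φ+sumL≡rCard : φ T S + sumL T S ≡ rCard T S
  φ+sumL≡rCard = begin
    φ T S + sumL T S
      ≡⟨ cong₂ _+_ φ≡∑ sumL≡∑ ⟩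
    ∑[ i < n ] 𝟙 (occ S i ∧ leftUnique i ∧ rightUnique i) + ∑[ i < n ] 𝟙 (occ S i ∧ not (leftUnique i) ∧ rightUnique i)
      ≡⟨ ∑-distrib-+ _ _ n ⟨
    ∑[ i < n ] (𝟙 (occ S i ∧ leftUnique i ∧ rightUnique i) + 𝟙 (occ S i ∧ not (leftUnique i) ∧ rightUnique i))
      ≡⟨ ∑-cong n (λ i _ → 𝟙-split (occ S i) (leftUnique i) (rightUnique i)) ⟩
    ∑[ i < n ] 𝟙 (occ S i ∧ rightUnique i)
      ≡⟨ rCard≡∑ ⟨
    rCard T S ∎

open import Data.Integer using (+_; _-_; _⊖_)
import Data.Integer.Properties as ℤ

theorem2 : (σ : ℕ) (T : List (Char σ)) →
    (Σ[ w ∈ List (Fin σ) ] T ≡ map just w ++ (nothing ∷ [])) →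
    (S : List (Char σ)) → 2 ≤ f T S →
    + (φ T S) ≡ + (rCard T S) - + (sumL T S)
theorem2 σ .(map just w ++ (nothing ∷ [])) (w , refl) S 2≤f = begin
  + φ T S                          ≡⟨ cong +_ (m+n∸n≡m (φ T S) (sumL T S)) ⟨
  + (φ T S + sumL T S ∸ sumL T S)  ≡⟨ ℤ.⊖-≥ (m≤n+m (sumL T S) (φ T S)) ⟨
  (φ T S + sumL T S) ⊖ sumL T S    ≡⟨ cong (_⊖ sumL T S) (NetFrequency.φ+sumL≡rCard w S 2≤f) ⟩
  rCard T S ⊖ sumL T S             ≡⟨ ℤ.m-n≡m⊖n (rCard T S) (sumL T S) ⟨
  + rCard T S - + sumL T S         ∎
  where open Sentinel w using (T)
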